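{- Let $\alpha=(\alpha_1,\ldots,\alpha_h)$ be a partition such that $\alpha\notin\mathrm{Sign}$, $(\alpha_2,\ldots,\alpha_h)\in\mathrm{Sign}$, $\alpha_1>\alpha_2>\alpha_3+\cdots+\alpha_h$, and $\alpha_1-\alpha_2<\alpha_h$. Then $\beta=(|\alpha|-\alpha_1,1^{\alpha_1})$ is a partition with $h^\beta_{2,1}=\alpha_1$ and $\chi^\beta_\alpha=2(-1)^{\alpha_1-1}$.
   Context: $|\lambda|$ is the sum of the parts of $\lambda$; $(b,1^m)$ denotes the partition with first part $b$ followed by $m$ parts equal to $1$. $h^\lambda_{i,j}$ is the hook length of node $(i,j)$ (row $i$, column $j$) of the Young diagram of $\lambda$. For partitions $\lambda,\mu$ of the same $n$, $\chi^\lambda_\mu$ is the value of the irreducible character of $S_n$ labeled by $\lambda$ on permutations of cycle type $\mu$. $\mathrm{Sign}$ denotes the set of all partitions $(\gamma_1,\ldots,\gamma_r)$ for which there exists $s$ with $0\leq s\leq r$ such that: (i) $\gamma_i>\gamma_{i+1}+\cdots+\gamma_r$ for $1\leq i\leq s$; and (ii) $(\gamma_{s+1},\ldots,\gamma_r)$ is one of $()$, $(1,1)$, $(3,2,1,1)$, $(5,3,2,1)$, $(a,a-1,1)$ with $a\geq 2$, $(a,a-1,2,1)$ with $a\geq 4$, or $(a,a-1,3,1)$ with $a\geq 5$. -}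

module Defs where

open import Data.Nat using (ℕ; zero; suc; _+_; _∸_; _≤_; _<_; _≡ᵇ_; _<ᵇ_; _≤ᵇ_)
open import Data.Bool using (Bool; true; false; if_then_else_; not; _∧_)
open import Data.List using (List; []; _∷_; length; filter; map; zipWith; downFrom; foldr)
open import Data.Nat.ListAction using (sum)
open import Data.Bool.ListAction using (any)
open import Data.List.Relation.Unary.All using (All)
open import Data.List.Relation.Unary.Linked using (Linked)
open import Data.Integer using (ℤ; +_; -_) renaming (_+_ to _+ℤ_; _*_ to _*ℤ_; _^_ to _^ℤ_)
open import Data.Product using (_×_; _,_; proj₁; proj₂)
open import Relation.Binary.PropositionalEquality using (_≡_)

IsPartition : List ℕ → Set
IsPartition λ′ = All (λ x → 1 ≤ x) λ′ × Linked (λ x y → y ≤ x) λ′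

size : List ℕ → ℕ
size = sum

-- i-th part (1-indexed), 0 if out of range
part : List ℕ → ℕ → ℕ
part []       _             = 0
part (x ∷ xs) zero          = 0
part (x ∷ xs) (suc zero)    = x
part (x ∷ xs) (suc (suc i)) = part xs (suc i)

colLen : List ℕ → ℕ → ℕ
colLen λ′ j = length (filter (λ x → j Data.Nat.≤? x) λ′)

IsNode : List ℕ → ℕ → ℕ → Set
IsNode λ′ i j = 1 ≤ i × 1 ≤ j × j ≤ part λ′ i

hook : List ℕ → ℕ → ℕ → ℕ
hook λ′ i j = (part λ′ i ∸ j) + (colLen λ′ j ∸ i) + 1

lastPart : ℕ → List ℕ → ℕ
lastPart x []       = x
lastPart x (y ∷ ys) = lastPart y ys

hookShape : ℕ → ℕ → List ℕ
hookShape b m = b ∷ Data.List.replicate m 1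

data SpecialTail : List ℕ → Set where
  t-empty : SpecialTail []
  t-11    : SpecialTail (1 ∷ 1 ∷ [])
  t-3211  : SpecialTail (3 ∷ 2 ∷ 1 ∷ 1 ∷ [])
  t-5321  : SpecialTail (5 ∷ 3 ∷ 2 ∷ 1 ∷ [])
  t-aa1-1  : ∀ a → 2 ≤ a → SpecialTail (a ∷ a ∸ 1 ∷ 1 ∷ [])
  t-aa1-21 : ∀ a → 4 ≤ a → SpecialTail (a ∷ a ∸ 1 ∷ 2 ∷ 1 ∷ [])
  t-aa1-31 : ∀ a → 5 ≤ a → SpecialTail (a ∷ a ∸ 1 ∷ 3 ∷ 1 ∷ [])

data SignShape : List ℕ → Set where
  tail : ∀ {γ} → SpecialTail γ → SignShape γ
  big  : ∀ {x γ} → sum γ < x → SignShape γ → SignShape (x ∷ γ)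

InSign : List ℕ → Set
InSign γ = IsPartition γ × SignShape γ

-- Irreducible characters of S_n via the Murnaghan–Nakayama rule,
-- implemented on beta-sets (first-column hook lengths):
-- λ with ℓ parts ↦ strictly decreasing list (λ_i + ℓ - i)_i.
-- Removing a rim hook of length k = replacing some b by b - k not in the set;
-- its leg length = number of beta numbers strictly between b - k and b.

betaSet : List ℕ → List ℕ
betaSet λ′ = zipWith _+_ λ′ (downFrom (length λ′))

memb : ℕ → List ℕ → Bool
memb c bs = any (λ x → x ≡ᵇ c) bs

insertDesc : ℕ → List ℕ → List ℕ
insertDesc c []       = c ∷ []
insertDesc c (x ∷ xs) = if x <ᵇ c then c ∷ x ∷ xs else x ∷ insertDesc c xs

removeN : ℕ → List ℕ → List ℕ
removeN b = filter (λ x → Data.Bool.Properties.T? (not (x ≡ᵇ b)))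
  where import Data.Bool.Properties

count : (ℕ → Bool) → List ℕ → ℕ
count p []       = 0
count p (x ∷ xs) = if p x then suc (count p xs) else count p xs

eqList : List ℕ → List ℕ → Bool
eqList []       []       = true
eqList (x ∷ xs) (y ∷ ys) = (x ≡ᵇ y) ∧ eqList xs ys
eqList _        _        = false

removals : ℕ → List ℕ → List (ℤ × List ℕ)
removals k bs = go bs
  where
  go : List ℕ → List (ℤ × List ℕ)
  go [] = []
  go (b ∷ rest) =
    if (k ≤ᵇ b) ∧ not (memb (b ∸ k) bs)
    then ((- (+ 1)) ^ℤ count (λ x → ((b ∸ k) <ᵇ x) ∧ (x <ᵇ b)) bs
           , insertDesc (b ∸ k) (removeN b bs)) ∷ go rest
    else go rest

sumℤ : List ℤ → ℤ
sumℤ = foldr _+ℤ_ (+ 0)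

χβ : List ℕ → List ℕ → ℤ
χβ bs []      = if eqList bs (downFrom (length bs)) then + 1 else + 0
χβ bs (k ∷ μ) = sumℤ (map (λ p → proj₁ p *ℤ χβ (proj₂ p) μ) (removals k bs))

χ : List ℕ → List ℕ → ℤ
χ λ′ μ = χβ (betaSet λ′) μ

{-# OPTIONS --safe #-}
-- With b = |α| − a₁, the beta-set of β = (b, 1^a₁) is {b + a₁, a₁, …, 1}, and χ^β_α is evaluated by the
-- Murnaghan–Nakayama rule on beta-sets. Since a₁ − a₂ < α_h ≤ |α| − a₁ − a₂ we have b > a₁, so an
-- a₁-rim hook can be removed in exactly two ways: from the arm, leaving the hook (b − a₁, 1^a₁), or as
-- the whole first column, leaving the row (b) with sign (−1)^(a₁−1). From (b − a₁, 1^a₁) the part a₂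
-- can only be removed from the bottom of the leg, with sign (−1)^(a₂−1), leaving a hook with leg
-- d = a₁ − a₂; every further part exceeds d, which forces the value (−1)^d. Both terms are (−1)^(a₁−1).
-- The Sign hypotheses only serve to exclude α = (a₁, a₂).
module Submission where

open import Defs
open import Data.Nat using (ℕ; _+_; _∸_; _<_)
open import Data.List using (List; []; _∷_)
open import Data.Integer using (ℤ; +_; -_; _*_; _^_)
open import Data.Product using (_×_)
open import Relation.Nullary using (¬_)
open import Relation.Binary.PropositionalEquality using (_≡_)

open import Data.Nat using (zero; suc; _≤_; z≤n; s≤s; _≤ᵇ_; _<ᵇ_; _≡ᵇ_)
open import Data.Nat.Properties
open import Data.Nat.ListAction using (sum)
open import Data.Bool using (Bool; true; false; T; not; _∧_; if_then_else_)
open import Data.Bool.Properties using (T-≡; T-not-≡; ∧-zeroʳ)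
open import Data.List using (replicate; downFrom; zipWith; length)
open import Data.List.Properties using (length-replicate; length-downFrom; filter-all; filter-accept; filter-reject)
open import Data.List.Membership.Propositional using (_∈_; _∉_)
open import Data.List.Membership.Propositional.Properties using (∈-downFrom⁺; ∈-downFrom⁻)
open import Data.List.Relation.Unary.All as All using (All; []; _∷_)
open import Data.List.Relation.Unary.All.Properties using (¬Any⇒All¬; replicate⁺)
open import Data.List.Relation.Unary.Any as Any using (here; there)
open import Data.List.Relation.Unary.Any.Properties using (any⁺; any⁻)
open import Data.List.Relation.Unary.Linked as Linked using (Linked; [-]; _∷_)
open import Data.Product using (_,_; proj₂)
open import Data.Empty using (⊥-elim)
open import Data.Unit using (tt)
open import Function using (_∘_)
open import Function.Bundles using (Equivalence)
open import Relation.Nullary using (yes; no)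
open import Relation.Nullary.Decidable.Core using (T?)
open import Relation.Binary.PropositionalEquality using (_≢_; refl; sym; trans; cong; cong₂; subst; subst₂; module ≡-Reasoning)
open import Data.Integer using () renaming (_+_ to _+ℤ_)
import Data.Integer.Properties as ℤ

T⇒≡true : ∀ {b} → T b → b ≡ true
T⇒≡true = Equivalence.to T-≡

¬T⇒≡false : ∀ {b} → ¬ T b → b ≡ false
¬T⇒≡false {false} _  = refl
¬T⇒≡false {true}  ¬t = ⊥-elim (¬t tt)

<ᵇ-false : ∀ {m n} → n ≤ m → (m <ᵇ n) ≡ false
<ᵇ-false {m} {n} n≤m = ¬T⇒≡false (λ t → <⇒≱ (<ᵇ⇒< m n t) n≤m)

≤ᵇ-false : ∀ {m n} → n < m → (m ≤ᵇ n) ≡ false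
≤ᵇ-false {m} {n} n<m = ¬T⇒≡false (λ t → <⇒≱ n<m (≤ᵇ⇒≤ m n t))

≢⇒T-not-≡ᵇ : ∀ {x y} → x ≢ y → T (not (x ≡ᵇ y))
≢⇒T-not-≡ᵇ {x} {y} x≢y = Equivalence.from T-not-≡ (¬T⇒≡false (x≢y ∘ ≡ᵇ⇒≡ x y))

m+n<o⇒n<o∸m : ∀ {m n o} → m + n < o → n < o ∸ m
m+n<o⇒n<o∸m {m} {n} {o} m+n<o =
  +-cancelˡ-< m n (o ∸ m) (subst (m + n <_) (sym (m+[n∸m]≡n m≤o)) m+n<o)
  where
  m≤o : m ≤ o
  m≤o = ≤-trans (m≤m+n m n) (<⇒≤ m+n<o)

0<m∸n⇒n<m : ∀ {m n} → 0 < m ∸ n → n < m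
0<m∸n⇒n<m 0<m∸n = m∸n≢0⇒n<m (>⇒≢ 0<m∸n)

m∸n<o⇒m<n+o : ∀ {m n o} → n ≤ m → m ∸ n < o → m < n + o
m∸n<o⇒m<n+o {m} {n} {o} n≤m m∸n<o = subst₂ _<_ (m+[n∸m]≡n n≤m) refl (+-monoʳ-< n m∸n<o)

n≤m<n+o⇒m∸n<o : ∀ {m n o} → n ≤ m → m < n + o → m ∸ n < o
n≤m<n+o⇒m∸n<o {m} {n} {o} n≤m m<n+o =
  +-cancelˡ-< n (m ∸ n) o (subst (_< n + o) (sym (m+[n∸m]≡n n≤m)) m<n+o)

sign : ℕ → ℤ
sign n = (- (+ 1)) ^ n

sign-+ : ∀ m n → sign (m + n) ≡ sign m * sign n
sign-+ = ℤ.^-distribˡ-+-* (- (+ 1))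

x+x≡2*x : ∀ x → x +ℤ x ≡ + 2 * x
x+x≡2*x x = sym (trans (ℤ.*-distribʳ-+ x (+ 1) (+ 1)) (cong₂ _+ℤ_ (ℤ.*-identityˡ x) (ℤ.*-identityˡ x)))

-- X ∷ gapped d m, i.e. {X} ∪ {0, …, d + m} ∖ {m}, is a beta-set of the hook (X ∸ (d + m), 1^d)
-- padded with m zero parts.
gapped : ℕ → ℕ → List ℕ
gapped zero    m = downFrom m
gapped (suc d) m = suc (d + m) ∷ gapped d m

downFrom-< : ∀ m → All (_< m) (downFrom m)
downFrom-< m = All.tabulate ∈-downFrom⁻

gapped-≤ : ∀ d m → All (_≤ d + m) (gapped d m)
gapped-≤ zero    m = All.map <⇒≤ (downFrom-< m)
gapped-≤ (suc d) m = ≤-refl ∷ All.map m≤n⇒m≤1+n (gapped-≤ d m)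

∈-gapped⁺ : ∀ {y} d m → y ≢ m → y ≤ d + m → y ∈ gapped d m
∈-gapped⁺     zero    m y≢m y≤m = ∈-downFrom⁺ (≤∧≢⇒< y≤m y≢m)
∈-gapped⁺ {y} (suc d) m y≢m y≤  with y ≟ suc (d + m)
... | yes y≡ = here y≡
... | no  y≢ = there (∈-gapped⁺ d m y≢m (≤-pred (≤∧≢⇒< y≤ y≢)))

gap-∉-gapped : ∀ d m → m ∉ gapped d m
gap-∉-gapped zero    m m∈         = <-irrefl refl (∈-downFrom⁻ m∈)
gap-∉-gapped (suc d) m (here m≡)  = <-irrefl m≡ (s≤s (m≤n+m m d))
gap-∉-gapped (suc d) m (there m∈) = gap-∉-gapped d m m∈

>⇒∉ : ∀ {n y xs} → All (_≤ n) xs → n < y → y ∉ xs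
>⇒∉ xs≤n n<y y∈ = <⇒≱ n<y (All.lookup xs≤n y∈)

∉-∷ : ∀ {y x : ℕ} {xs} → y ≢ x → y ∉ xs → y ∉ x ∷ xs
∉-∷ y≢x _   (here y≡x) = y≢x y≡x
∉-∷ _   y∉ (there y∈) = y∉ y∈

gap-∉-hookBeta : ∀ {X} d m → m < X → m ∉ X ∷ gapped d m
gap-∉-hookBeta d m m<X = ∉-∷ (<⇒≢ m<X) (gap-∉-gapped d m)

top-∉-hookBeta : ∀ {X y} d m → d + m < y → y < X → y ∉ X ∷ gapped d m
top-∉-hookBeta d m dm<y y<X = ∉-∷ (<⇒≢ y<X) (>⇒∉ (gapped-≤ d m) dm<y)

memb-∈ : ∀ {y bs} → y ∈ bs → memb y bs ≡ true
memb-∈ {y} y∈ = T⇒≡true (any⁺ (_≡ᵇ y) (Any.map (λ {x} y≡x → ≡⇒≡ᵇ x y (sym y≡x)) y∈))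

memb-∉ : ∀ {y bs} → y ∉ bs → memb y bs ≡ false
memb-∉ {y} {bs} y∉ =
  ¬T⇒≡false (λ t → y∉ (Any.map (λ {x} t′ → sym (≡ᵇ⇒≡ x y t′)) (any⁻ (_≡ᵇ y) bs t)))

removeN-∉ : ∀ {y} xs → y ∉ xs → removeN y xs ≡ xs
removeN-∉ {y} xs y∉ =
  filter-all (λ x → T? (not (x ≡ᵇ y))) (All.map (λ y≢x → ≢⇒T-not-≡ᵇ (y≢x ∘ sym)) (¬Any⇒All¬ xs y∉))

removeN-here : ∀ {y} xs → y ∉ xs → removeN y (y ∷ xs) ≡ xs
removeN-here {y} xs y∉ =
  trans (filter-reject (λ x → T? (not (x ≡ᵇ y))) {y} {xs}
                       (λ t → subst T (Equivalence.to T-not-≡ t) (≡⇒≡ᵇ y y refl)))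
        (removeN-∉ xs y∉)

removeN-there : ∀ {y x} xs → x ≢ y → removeN y (x ∷ xs) ≡ x ∷ removeN y xs
removeN-there {y} _ x≢y = filter-accept (λ x → T? (not (x ≡ᵇ y))) (≢⇒T-not-≡ᵇ x≢y)

insertDesc-< : ∀ {y x} xs → x < y → insertDesc y (x ∷ xs) ≡ y ∷ x ∷ xs
insertDesc-< _ x<y rewrite T⇒≡true (<⇒<ᵇ x<y) = refl

insertDesc-≥ : ∀ {y x} xs → y ≤ x → insertDesc y (x ∷ xs) ≡ x ∷ insertDesc y xs
insertDesc-≥ _ y≤x rewrite <ᵇ-false y≤x = refl

insertDesc-top : ∀ {y xs} → All (_< y) xs → insertDesc y xs ≡ y ∷ xs
insertDesc-top []                   = refl
insertDesc-top {xs = _ ∷ xs} (x<y ∷ _) = insertDesc-< xs x<y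

insertDesc-gap : ∀ d m → insertDesc m (gapped d m) ≡ downFrom (suc (d + m))
insertDesc-gap zero    m = insertDesc-top (downFrom-< m)
insertDesc-gap (suc d) m =
  trans (insertDesc-≥ (gapped d m) (≤-trans (m≤n+m m d) (n≤1+n _))) (cong (suc (d + m) ∷_) (insertDesc-gap d m))

insertDesc-removeN-column : ∀ {k} d m → 1 ≤ k → insertDesc m (removeN (k + m) (gapped (d + k) m)) ≡ gapped d (k + m)
insertDesc-removeN-column {suc k} zero m _ =
  trans (cong (insertDesc m) (removeN-here (gapped k m) (>⇒∉ (gapped-≤ k m) (n<1+n (k + m)))))
        (insertDesc-gap k m)
insertDesc-removeN-column {suc k} (suc d) m _ = begin
  insertDesc m (removeN (suc k + m) (h ∷ gapped (d + suc k) m))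
    ≡⟨ cong (insertDesc m) (removeN-there (gapped (d + suc k) m) (>⇒≢ k+m<h)) ⟩
  insertDesc m (h ∷ removeN (suc k + m) (gapped (d + suc k) m))
    ≡⟨ insertDesc-≥ _ (≤-trans (m≤n+m m (suc k)) (<⇒≤ k+m<h)) ⟩
  h ∷ insertDesc m (removeN (suc k + m) (gapped (d + suc k) m))
    ≡⟨ cong₂ _∷_ (cong suc (+-assoc d (suc k) m)) (insertDesc-removeN-column d m (s≤s z≤n)) ⟩
  gapped (suc d) (suc k + m) ∎
  where
  open ≡-Reasoning
  h : ℕ
  h = suc (d + suc k + m)
  k+m<h : suc k + m < h
  k+m<h = s≤s (+-monoˡ-≤ m (m≤n+m (suc k) d))

between : ℕ → ℕ → ℕ → Bool
between lo hi x = (lo <ᵇ x) ∧ (x <ᵇ hi)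

count-between-≤ : ∀ lo hi {xs} → All (_≤ lo) xs → count (between lo hi) xs ≡ 0
count-between-≤ lo hi []             = refl
count-between-≤ lo hi (x≤lo ∷ xs≤lo) rewrite <ᵇ-false x≤lo = count-between-≤ lo hi xs≤lo

count-between-≥ : ∀ lo hi x xs → hi ≤ x → count (between lo hi) (x ∷ xs) ≡ count (between lo hi) xs
count-between-≥ lo hi x xs hi≤x rewrite <ᵇ-false hi≤x | ∧-zeroʳ (lo <ᵇ x) = refl

count-between-< : ∀ lo hi x xs → lo < x → x < hi → count (between lo hi) (x ∷ xs) ≡ suc (count (between lo hi) xs)
count-between-< lo hi x xs lo<x x<hi rewrite T⇒≡true (<⇒<ᵇ lo<x) | T⇒≡true (<⇒<ᵇ x<hi) = refl

count-between-gapped : ∀ {hi} d m → d + m < hi → count (between m hi) (gapped d m) ≡ d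
count-between-gapped {hi} zero    m _      = count-between-≤ m hi (All.map <⇒≤ (downFrom-< m))
count-between-gapped {hi} (suc d) m d+m<hi =
  trans (count-between-< m hi (suc (d + m)) (gapped d m) (s≤s (m≤n+m m d)) d+m<hi)
        (cong suc (count-between-gapped d m (<-trans (n<1+n _) d+m<hi)))

count-between-column : ∀ {k} d m → 1 ≤ k → count (between m (k + m)) (gapped (d + k) m) ≡ k ∸ 1
count-between-column {suc k} zero    m _ =
  trans (count-between-≥ m (suc k + m) (suc k + m) (gapped k m) ≤-refl) (count-between-gapped k m (n<1+n (k + m)))
count-between-column {suc k} (suc d) m _ =
  trans (count-between-≥ m (suc k + m) (suc (d + suc k + m)) (gapped (d + suc k) m)
                         (m≤n⇒m≤1+n (+-monoˡ-≤ m (m≤n+m (suc k) d))))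
        (count-between-column d m (s≤s z≤n))

removable : ℕ → List ℕ → ℕ → Bool
removable k bs b = (k ≤ᵇ b) ∧ not (memb (b ∸ k) bs)

removal : ℕ → List ℕ → ℕ → ℤ × List ℕ
removal k bs b = sign (count (between (b ∸ k) b) bs) , insertDesc (b ∸ k) (removeN b bs)

removalStep : ℕ → List ℕ → ℕ → List (ℤ × List ℕ) → List (ℤ × List ℕ)
removalStep k bs b r = if removable k bs b then removal k bs b ∷ r else r

-- removals k bs traverses bs with a local function that cannot be named; removalsFrom k bs is that function.
removalsFrom : ℕ → List ℕ → List ℕ → List (ℤ × List ℕ)
removalsFrom k bs []      = []
removalsFrom k bs (b ∷ l) = removalStep k bs b (removalsFrom k bs l)

removalsFrom-unique : ∀ {k bs} (f : List ℕ → List (ℤ × List ℕ)) → f [] ≡ [] →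
  (∀ b l → f (b ∷ l) ≡ removalStep k bs b (f l)) → ∀ l → f l ≡ removalsFrom k bs l
removalsFrom-unique f f[] f∷ []      = f[]
removalsFrom-unique {k} {bs} f f[] f∷ (b ∷ l) =
  trans (f∷ b l) (cong (removalStep k bs b) (removalsFrom-unique f f[] f∷ l))

-- Generalising the beta-set and then its tail makes the local function of removals the solution of f;
-- _∷_ is qualified because the overloaded constructor would otherwise not be generalised.
removals≡removalsFrom : ∀ k X d m → removals k (X ∷ gapped d m) ≡ removalsFrom k (X ∷ gapped d m) (X ∷ gapped d m)
removals≡removalsFrom k X d m with Data.List._∷_ X (gapped d m)
... | bs with gapped d m | removalsFrom-unique {k} {bs} _
... | l | unique = cong (removalStep k (X ∷ l) X) (unique refl (λ _ _ → refl) l)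

removalsFrom-skip : ∀ {k bs} b l → removable k bs b ≡ false → removalsFrom k bs (b ∷ l) ≡ removalsFrom k bs l
removalsFrom-skip _ _ r rewrite r = refl

removalsFrom-take : ∀ {k bs} b l → removable k bs b ≡ true →
  removalsFrom k bs (b ∷ l) ≡ removal k bs b ∷ removalsFrom k bs l
removalsFrom-take _ _ r rewrite r = refl

unremovable-< : ∀ {k b} bs → b < k → removable k bs b ≡ false
unremovable-< {k} {b} bs b<k = cong (_∧ not (memb (b ∸ k) bs)) (≤ᵇ-false b<k)

unremovable-∈ : ∀ k b {bs} → b ∸ k ∈ bs → removable k bs b ≡ false
unremovable-∈ k b b∸k∈ = trans (cong (λ c → (k ≤ᵇ b) ∧ not c) (memb-∈ b∸k∈)) (∧-zeroʳ _)

removable-∉ : ∀ {k b bs} → k ≤ b → b ∸ k ∉ bs → removable k bs b ≡ true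
removable-∉ k≤b b∸k∉ = cong₂ (λ c e → c ∧ not e) (T⇒≡true (≤⇒≤ᵇ k≤b)) (memb-∉ b∸k∉)

removalsFrom-none : ∀ {k bs l} → All (λ b → removable k bs b ≡ false) l → removalsFrom k bs l ≡ []
removalsFrom-none []                 = refl
removalsFrom-none {l = b ∷ l} (r ∷ rs) = trans (removalsFrom-skip b l r) (removalsFrom-none rs)

removalsFrom-gapped-none : ∀ {k bs} d m → d < k → (∀ {y} → y < m → y ∈ bs) → removalsFrom k bs (gapped d m) ≡ []
removalsFrom-gapped-none {k} {bs} d m d<k below-m∈ = removalsFrom-none (All.map unremovable (gapped-≤ d m))
  where
  unremovable : ∀ {b} → b ≤ d + m → removable k bs b ≡ false
  unremovable {b} b≤d+m with b <? k
  ... | yes b<k = unremovable-< bs b<k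
  ... | no  b≮k = unremovable-∈ k b (below-m∈ (n≤m<n+o⇒m∸n<o (≮⇒≥ b≮k) (≤-<-trans b≤d+m (+-monoˡ-< m d<k))))

-- Moving an entry down by k lands on an entry of bs unless it starts at k + m and lands in the gap m.
removalsFrom-column : ∀ {k bs} d m → 1 ≤ k → m ∉ bs → (∀ {y} → y ≢ m → y ≤ d + k + m → y ∈ bs) →
  removalsFrom k bs (gapped (d + k) m) ≡ removal k bs (k + m) ∷ []
removalsFrom-column {suc k} {bs} zero m _ m∉ ∈bs =
  trans (removalsFrom-take (suc k + m) (gapped k m)
           (removable-∉ (m≤m+n (suc k) m) (subst (_∉ bs) (sym (m+n∸m≡n (suc k) m)) m∉)))
        (cong (removal (suc k) bs (suc k + m) ∷_)
              (removalsFrom-gapped-none k m (n<1+n k) (λ y<m → ∈bs (<⇒≢ y<m) (≤-trans (<⇒≤ y<m) (m≤n+m m (suc k))))))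
removalsFrom-column {suc k} {bs} (suc d) m _ m∉ ∈bs =
  trans (removalsFrom-skip h (gapped (d + suc k) m) (unremovable-∈ (suc k) h (∈bs h∸k≢m (m∸n≤m h (suc k)))))
        (removalsFrom-column d m (s≤s z≤n) m∉ (λ y≢m y≤ → ∈bs y≢m (m≤n⇒m≤1+n y≤)))
  where
  h : ℕ
  h = suc (d + suc k + m)
  h∸k≢m : h ∸ suc k ≢ m
  h∸k≢m h∸k≡m = <⇒≢ (m+n<o⇒n<o∸m (s≤s (+-monoˡ-≤ m (m≤n+m (suc k) d)))) (sym h∸k≡m)

removals-hook : ∀ {k X} d m → d < k → k ≤ X → X ∸ k ∉ X ∷ gapped d m →
  removals k (X ∷ gapped d m) ≡ removal k (X ∷ gapped d m) X ∷ []
removals-hook {k} {X} d m d<k k≤X X∸k∉ =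
  trans (removals≡removalsFrom k X d m)
        (trans (removalsFrom-take X (gapped d m) (removable-∉ k≤X X∸k∉))
               (cong (removal k (X ∷ gapped d m) X ∷_) (removalsFrom-gapped-none d m d<k below-m∈)))
  where
  below-m∈ : ∀ {y} → y < m → y ∈ X ∷ gapped d m
  below-m∈ y<m = there (∈-gapped⁺ d m (<⇒≢ y<m) (≤-trans (<⇒≤ y<m) (m≤n+m m d)))

removalsFrom-hookBeta-column : ∀ {k X} d m → 1 ≤ k → d + k + m < X →
  removalsFrom k (X ∷ gapped (d + k) m) (gapped (d + k) m) ≡ removal k (X ∷ gapped (d + k) m) (k + m) ∷ []
removalsFrom-hookBeta-column {k} d m 1≤k d+k+m<X =
  removalsFrom-column d m 1≤k (gap-∉-hookBeta (d + k) m (≤-<-trans (m≤n+m m (d + k)) d+k+m<X))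
                               (λ y≢m y≤ → there (∈-gapped⁺ (d + k) m y≢m y≤))

removals-column-blocked : ∀ {k X} d m → 1 ≤ k → d + k + m < X → X ∸ k ∈ gapped (d + k) m →
  removals k (X ∷ gapped (d + k) m) ≡ removal k (X ∷ gapped (d + k) m) (k + m) ∷ []
removals-column-blocked {k} {X} d m 1≤k d+k+m<X X∸k∈ =
  trans (removals≡removalsFrom k X (d + k) m)
        (trans (removalsFrom-skip X (gapped (d + k) m) (unremovable-∈ k X (there {x = X} X∸k∈)))
               (removalsFrom-hookBeta-column d m 1≤k d+k+m<X))

removals-column-free : ∀ {k X} d m → 1 ≤ k → d + k + m < X ∸ k →
  removals k (X ∷ gapped (d + k) m)
    ≡ removal k (X ∷ gapped (d + k) m) X ∷ removal k (X ∷ gapped (d + k) m) (k + m) ∷ []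
removals-column-free {k} {X} d m 1≤k d+k+m<X∸k =
  trans (removals≡removalsFrom k X (d + k) m)
        (trans (removalsFrom-take X (gapped (d + k) m)
                                  (removable-∉ k≤X (top-∉-hookBeta {X} (d + k) m d+k+m<X∸k (∸-monoʳ-< 1≤k k≤X))))
               (cong (removal k (X ∷ gapped (d + k) m) X ∷_)
                     (removalsFrom-hookBeta-column d m 1≤k (<-≤-trans d+k+m<X∸k (m∸n≤m X k)))))
  where
  k≤X : k ≤ X
  k≤X = <⇒≤ (0<m∸n⇒n<m (≤-<-trans z≤n d+k+m<X∸k))

removal-≡ : ∀ k {b y} bs → b ∸ k ≡ y → removal k bs b ≡ (sign (count (between y b) bs) , insertDesc y (removeN b bs))
removal-≡ _ _ refl = refl

removal-top : ∀ {k X y} d m → X ∸ k ≡ y → d + m < y → y < X → removal k (X ∷ gapped d m) X ≡ (+ 1 , y ∷ gapped d m)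
removal-top {k} {X} {y} d m X∸k≡y d+m<y y<X =
  trans (removal-≡ k (X ∷ gapped d m) X∸k≡y) (cong₂ _,_ (cong sign none-between) inserted)
  where
  none-between : count (between y X) (X ∷ gapped d m) ≡ 0
  none-between = trans (count-between-≥ y X X (gapped d m) ≤-refl)
                       (count-between-≤ y X (All.map (λ b≤ → ≤-trans b≤ (<⇒≤ d+m<y)) (gapped-≤ d m)))
  inserted : insertDesc y (removeN X (X ∷ gapped d m)) ≡ y ∷ gapped d m
  inserted = trans (cong (insertDesc y) (removeN-here (gapped d m) (>⇒∉ (gapped-≤ d m) (<-trans d+m<y y<X))))
                   (insertDesc-top (All.map (λ b≤ → ≤-<-trans b≤ d+m<y) (gapped-≤ d m)))

removal-gap : ∀ {k X} d m → X ∸ k ≡ m → d + m < X → removal k (X ∷ gapped d m) X ≡ (sign d , downFrom (suc (d + m)))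
removal-gap {k} {X} d m X∸k≡m d+m<X =
  trans (removal-≡ k (X ∷ gapped d m) X∸k≡m)
        (cong₂ _,_ (cong sign (trans (count-between-≥ m X X (gapped d m) ≤-refl) (count-between-gapped d m d+m<X)))
                   (trans (cong (insertDesc m) (removeN-here (gapped d m) (>⇒∉ (gapped-≤ d m) d+m<X)))
                          (insertDesc-gap d m)))

removal-column : ∀ {k X} d m → 1 ≤ k → d + k + m < X →
  removal k (X ∷ gapped (d + k) m) (k + m) ≡ (sign (k ∸ 1) , X ∷ gapped d (k + m))
removal-column {k} {X} d m 1≤k d+k+m<X =
  trans (removal-≡ k (X ∷ gapped (d + k) m) (m+n∸m≡n k m)) (cong₂ _,_ (cong sign between-count) inserted)
  where
  open ≡-Reasoning
  k+m<X : k + m < X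
  k+m<X = ≤-<-trans (+-monoˡ-≤ m (m≤n+m k d)) d+k+m<X
  between-count : count (between m (k + m)) (X ∷ gapped (d + k) m) ≡ k ∸ 1
  between-count = trans (count-between-≥ m (k + m) X (gapped (d + k) m) (<⇒≤ k+m<X)) (count-between-column d m 1≤k)
  inserted : insertDesc m (removeN (k + m) (X ∷ gapped (d + k) m)) ≡ X ∷ gapped d (k + m)
  inserted = begin
    insertDesc m (removeN (k + m) (X ∷ gapped (d + k) m))
      ≡⟨ cong (insertDesc m) (removeN-there (gapped (d + k) m) (>⇒≢ k+m<X)) ⟩
    insertDesc m (X ∷ removeN (k + m) (gapped (d + k) m))
      ≡⟨ insertDesc-≥ _ (≤-trans (m≤n+m m k) (<⇒≤ k+m<X)) ⟩
    X ∷ insertDesc m (removeN (k + m) (gapped (d + k) m))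
      ≡⟨ cong (X ∷_) (insertDesc-removeN-column d m 1≤k) ⟩
    X ∷ gapped d (k + m) ∎

eqList-refl : ∀ xs → eqList xs xs ≡ true
eqList-refl []       = refl
eqList-refl (x ∷ xs) rewrite T⇒≡true (≡⇒≡ᵇ x x refl) = eqList-refl xs

χβ-downFrom : ∀ n → χβ (downFrom n) [] ≡ + 1
χβ-downFrom n rewrite length-downFrom n | eqList-refl (downFrom n) = refl

χβ-one-removal : ∀ k bs μ {ε bs′} → removals k bs ≡ (ε , bs′) ∷ [] → χβ bs (k ∷ μ) ≡ ε * χβ bs′ μ
χβ-one-removal _ _ _ rs rewrite rs = ℤ.+-identityʳ _

χβ-two-removals : ∀ k bs μ {ε bs′ ε′ bs″} → removals k bs ≡ (ε , bs′) ∷ (ε′ , bs″) ∷ [] →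
  χβ bs (k ∷ μ) ≡ ε * χβ bs′ μ +ℤ ε′ * χβ bs″ μ
χβ-two-removals _ _ μ {ε} {bs′} {ε′} {bs″} rs rewrite rs =
  cong (ε * χβ bs′ μ +ℤ_) (ℤ.+-identityʳ (ε′ * χβ bs″ μ))

+-∸-cancelˡ : ∀ k s m → k + s + m ∸ k ≡ s + m
+-∸-cancelˡ k s m = trans (cong (_∸ k) (+-assoc k s m)) (m+n∸m≡n k (s + m))

-- Each part but the last is removed from the arm; the last one takes the whole hook.
χβ-hook : ∀ d m k μ → d < k → All (d <_) μ → χβ (k + sum μ + m ∷ gapped d m) (k ∷ μ) ≡ sign d
χβ-hook d m k [] d<k [] = begin
  χβ (X ∷ gapped d m) (k ∷ [])              ≡⟨ χβ-one-removal k (X ∷ gapped d m) [] removals-gap ⟩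
  sign d * χβ (downFrom (suc (d + m))) []   ≡⟨ cong (sign d *_) (χβ-downFrom (suc (d + m))) ⟩
  sign d * + 1                              ≡⟨ ℤ.*-identityʳ (sign d) ⟩
  sign d                                    ∎
  where
  open ≡-Reasoning
  X : ℕ
  X = k + 0 + m
  d+m<X : d + m < X
  d+m<X = +-monoˡ-< m (<-≤-trans d<k (m≤m+n k 0))
  removals-gap : removals k (X ∷ gapped d m) ≡ (sign d , downFrom (suc (d + m))) ∷ []
  removals-gap =
    trans (removals-hook d m d<k (≤-trans (m≤m+n k 0) (m≤m+n (k + 0) m))
                         (subst (_∉ X ∷ gapped d m) (sym (+-∸-cancelˡ k 0 m))
                                (gap-∉-hookBeta d m (≤-<-trans (m≤n+m m d) d+m<X))))
          (cong (_∷ []) (removal-gap {k} d m (+-∸-cancelˡ k 0 m) d+m<X))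
χβ-hook d m k (k′ ∷ μ) d<k (d<k′ ∷ d<μ) = begin
  χβ (X ∷ gapped d m) (k ∷ k′ ∷ μ)          ≡⟨ χβ-one-removal k (X ∷ gapped d m) (k′ ∷ μ) removals-top ⟩
  + 1 * χβ (Y ∷ gapped d m) (k′ ∷ μ)        ≡⟨ ℤ.*-identityˡ _ ⟩
  χβ (Y ∷ gapped d m) (k′ ∷ μ)              ≡⟨ χβ-hook d m k′ μ d<k′ d<μ ⟩
  sign d                                    ∎
  where
  open ≡-Reasoning
  s X Y : ℕ
  s = k′ + sum μ
  X = k + s + m
  Y = s + m
  d+m<Y : d + m < Y
  d+m<Y = +-monoˡ-< m (<-≤-trans d<k′ (m≤m+n k′ (sum μ)))
  Y<X : Y < X
  Y<X = +-monoˡ-< m (m<n+m s (≤-<-trans z≤n d<k))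
  removals-top : removals k (X ∷ gapped d m) ≡ (+ 1 , Y ∷ gapped d m) ∷ []
  removals-top =
    trans (removals-hook d m d<k (≤-trans (m≤m+n k s) (m≤m+n (k + s) m))
                         (subst (_∉ X ∷ gapped d m) (sym (+-∸-cancelˡ k s m)) (top-∉-hookBeta d m d+m<Y Y<X)))
          (cong (_∷ []) (removal-top {k} d m (+-∸-cancelˡ k s m) d+m<Y Y<X))

χβ-column-free : ∀ {k X y} d m μ → 1 ≤ k → X ∸ k ≡ y → d + k + m < y →
  χβ (X ∷ gapped (d + k) m) (k ∷ μ) ≡ χβ (y ∷ gapped (d + k) m) μ +ℤ sign (k ∸ 1) * χβ (X ∷ gapped d (k + m)) μ
χβ-column-free {k} {X} {y} d m μ 1≤k X∸k≡y d+k+m<y =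
  trans (χβ-two-removals k (X ∷ gapped (d + k) m) μ
           (trans (removals-column-free d m 1≤k (subst (d + k + m <_) (sym X∸k≡y) d+k+m<y))
                  (cong₂ (λ r r′ → r ∷ r′ ∷ [])
                         (removal-top {k} (d + k) m X∸k≡y d+k+m<y y<X)
                         (removal-column d m 1≤k (<-trans d+k+m<y y<X)))))
        (cong (_+ℤ sign (k ∸ 1) * χβ (X ∷ gapped d (k + m)) μ) (ℤ.*-identityˡ (χβ (y ∷ gapped (d + k) m) μ)))
  where
  y<X : y < X
  y<X = subst (_< X) X∸k≡y (∸-monoʳ-< 1≤k (<⇒≤ (0<m∸n⇒n<m (subst (0 <_) (sym X∸k≡y) (≤-<-trans z≤n d+k+m<y)))))

χβ-column-blocked : ∀ {k X} d m μ → 1 ≤ k → d + k + m < X → X ∸ k ∈ gapped (d + k) m →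
  χβ (X ∷ gapped (d + k) m) (k ∷ μ) ≡ sign (k ∸ 1) * χβ (X ∷ gapped d (k + m)) μ
χβ-column-blocked {k} {X} d m μ 1≤k d+k+m<X X∸k∈ =
  χβ-one-removal k (X ∷ gapped (d + k) m) μ
    (trans (removals-column-blocked d m 1≤k d+k+m<X X∸k∈) (cong (_∷ []) (removal-column d m 1≤k d+k+m<X)))

betaSet-hookShape : ∀ b a → betaSet (hookShape b a) ≡ b + a ∷ gapped a 0
betaSet-hookShape b a =
  trans (cong (λ n → zipWith _+_ (hookShape b a) (downFrom (suc n))) (length-replicate a))
        (cong (b + a ∷_) (ones a))
  where
  ones : ∀ a → zipWith _+_ (replicate a 1) (downFrom a) ≡ gapped a 0
  ones zero    = refl
  ones (suc a) = cong₂ _∷_ (cong suc (sym (+-identityʳ a))) (ones a)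

hookShape-isPartition : ∀ {b} a → 1 ≤ b → IsPartition (hookShape b a)
hookShape-isPartition a 1≤b = (1≤b ∷ replicate⁺ a ≤-refl) , decreasing a 1≤b
  where
  decreasing : ∀ {b} a → 1 ≤ b → Linked (λ x y → y ≤ x) (hookShape b a)
  decreasing zero    _   = [-]
  decreasing (suc a) 1≤b = 1≤b ∷ decreasing a ≤-refl

hookShape-node₂₁ : ∀ b {a} → 1 ≤ a → IsNode (hookShape b a) 2 1
hookShape-node₂₁ _ (s≤s _) = s≤s z≤n , s≤s z≤n , s≤s z≤n

hook-hookShape₂₁ : ∀ {b a} → 1 ≤ b → 1 ≤ a → hook (hookShape b a) 2 1 ≡ a
hook-hookShape₂₁ {suc b} {suc a} _ _ =
  trans (cong (_+ 1) (trans (cong length (filter-all (1 ≤?_) (replicate⁺ a ≤-refl))) (length-replicate a)))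
        (+-comm a 1)

∉Sign⇒≤size : ∀ {x γ} → IsPartition (x ∷ γ) → ¬ InSign (x ∷ γ) → InSign γ → x ≤ size γ
∉Sign⇒≤size isP ∉Sign (_ , γ-shape) = ≮⇒≥ (λ size<x → ∉Sign (isP , big size<x γ-shape))

lastPart-≤ : ∀ x xs → Linked (λ x y → y ≤ x) (x ∷ xs) → All (lastPart x xs ≤_) (x ∷ xs)
lastPart-≤ x []       _          = ≤-refl ∷ []
lastPart-≤ x (y ∷ ys) (y≤x ∷ ys↓) with lastPart-≤ y ys ys↓
... | last≤y ∷ last≤ys = ≤-trans last≤y y≤x ∷ last≤y ∷ last≤ys

-- Moving the arm entry j + s down by j would land on s, an entry since 1 ≤ s ≤ a; so j shortens the leg.
χβ-shorten-leg : ∀ a j k μ → j ≤ a → k + sum μ < j → All (a ∸ j <_) (k ∷ μ) →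
  χβ (j + (k + sum μ) ∷ gapped a 0) (j ∷ k ∷ μ) ≡ sign (j ∸ 1) * sign (a ∸ j)
χβ-shorten-leg a j k μ j≤a s<j (d<k ∷ d<μ) = begin
  χβ (b ∷ gapped a 0) (j ∷ k ∷ μ)
    ≡⟨ cong (λ a′ → χβ (b ∷ gapped a′ 0) (j ∷ k ∷ μ)) (sym d+j≡a) ⟩
  χβ (b ∷ gapped (d + j) 0) (j ∷ k ∷ μ)
    ≡⟨ χβ-column-blocked d 0 (k ∷ μ) 1≤j d+j+0<b b∸j∈ ⟩
  sign (j ∸ 1) * χβ (b ∷ gapped d (j + 0)) (k ∷ μ)
    ≡⟨ cong (λ X → sign (j ∸ 1) * χβ (X ∷ gapped d (j + 0)) (k ∷ μ))
            (trans (+-comm j s) (cong (_+_ s) (sym (+-identityʳ j)))) ⟩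
  sign (j ∸ 1) * χβ (s + (j + 0) ∷ gapped d (j + 0)) (k ∷ μ)
    ≡⟨ cong (sign (j ∸ 1) *_) (χβ-hook d (j + 0) k μ d<k d<μ) ⟩
  sign (j ∸ 1) * sign d ∎
  where
  open ≡-Reasoning
  s b d : ℕ
  s = k + sum μ
  b = j + s
  d = a ∸ j
  1≤j : 1 ≤ j
  1≤j = ≤-<-trans z≤n s<j
  d+j≡a : d + j ≡ a
  d+j≡a = m∸n+n≡m j≤a
  d<s : d < s
  d<s = <-≤-trans d<k (m≤m+n k (sum μ))
  d+j+0<b : d + j + 0 < b
  d+j+0<b = subst (_< b) (sym (trans (+-identityʳ (d + j)) d+j≡a)) (m∸n<o⇒m<n+o j≤a d<s)
  b∸j∈ : b ∸ j ∈ gapped (d + j) 0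
  b∸j∈ = subst (_∈ gapped (d + j) 0) (sym (m+n∸m≡n j s))
               (∈-gapped⁺ (d + j) 0 (>⇒≢ (≤-<-trans z≤n d<s))
                          (≤-trans (<⇒≤ s<j) (≤-trans (m≤n+m j d) (m≤m+n (d + j) 0))))

χ-hookShape≡±2 : ∀ a₁ a₂ k μ → a₂ < a₁ → k + sum μ < a₂ → All (a₁ ∸ a₂ <_) (k ∷ μ) →
  χ (hookShape (a₂ + (k + sum μ)) a₁) (a₁ ∷ a₂ ∷ k ∷ μ) ≡ + 2 * sign (a₁ ∸ 1)
χ-hookShape≡±2 a₁ a₂ k μ a₂<a₁ s<a₂ d<parts@(d<k ∷ _) = begin
  χ (hookShape b a₁) (a₁ ∷ a₂ ∷ k ∷ μ)
    ≡⟨ cong (λ bs → χβ bs (a₁ ∷ a₂ ∷ k ∷ μ)) (betaSet-hookShape b a₁) ⟩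
  χβ (b + a₁ ∷ gapped (0 + a₁) 0) (a₁ ∷ a₂ ∷ k ∷ μ)
    ≡⟨ χβ-column-free 0 0 (a₂ ∷ k ∷ μ) 1≤a₁ (m+n∸n≡m b a₁) a₁+0<b ⟩
  χβ (b ∷ gapped a₁ 0) (a₂ ∷ k ∷ μ) +ℤ sign (a₁ ∸ 1) * χβ (b + a₁ ∷ gapped 0 (a₁ + 0)) (a₂ ∷ k ∷ μ)
    ≡⟨ cong₂ (λ u v → u +ℤ sign (a₁ ∸ 1) * v)
             (χβ-shorten-leg a₁ a₂ k μ (<⇒≤ a₂<a₁) s<a₂ d<parts) one-row ⟩
  sign (a₂ ∸ 1) * sign (a₁ ∸ a₂) +ℤ sign (a₁ ∸ 1) * + 1
    ≡⟨ cong₂ _+ℤ_ (trans (sym (sign-+ (a₂ ∸ 1) (a₁ ∸ a₂))) (cong sign exponent)) (ℤ.*-identityʳ _) ⟩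
  sign (a₁ ∸ 1) +ℤ sign (a₁ ∸ 1)
    ≡⟨ x+x≡2*x _ ⟩
  + 2 * sign (a₁ ∸ 1) ∎
  where
  open ≡-Reasoning
  s b : ℕ
  s = k + sum μ
  b = a₂ + s
  1≤a₂ : 1 ≤ a₂
  1≤a₂ = ≤-<-trans z≤n s<a₂
  1≤a₁ : 1 ≤ a₁
  1≤a₁ = ≤-trans 1≤a₂ (<⇒≤ a₂<a₁)
  a₁+0<b : a₁ + 0 < b
  a₁+0<b = subst (_< b) (sym (+-identityʳ a₁)) (m∸n<o⇒m<n+o (<⇒≤ a₂<a₁) (<-≤-trans d<k (m≤m+n k (sum μ))))
  exponent : a₂ ∸ 1 + (a₁ ∸ a₂) ≡ a₁ ∸ 1
  exponent = trans (+-comm (a₂ ∸ 1) (a₁ ∸ a₂))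
                   (trans (sym (+-∸-assoc (a₁ ∸ a₂) 1≤a₂)) (cong (_∸ 1) (m∸n+n≡m (<⇒≤ a₂<a₁))))
  one-row : χβ (b + a₁ ∷ gapped 0 (a₁ + 0)) (a₂ ∷ k ∷ μ) ≡ + 1
  one-row = trans (cong (λ X → χβ (X ∷ gapped 0 (a₁ + 0)) (a₂ ∷ k ∷ μ)) (cong (_+_ b) (sym (+-identityʳ a₁))))
                  (χβ-hook 0 (a₁ + 0) a₂ (k ∷ μ) 1≤a₂ (All.map (≤-<-trans z≤n) d<parts))

theorem10 : (a₁ a₂ : ℕ) (rest : List ℕ) →
    IsPartition (a₁ ∷ a₂ ∷ rest) →
    ¬ InSign (a₁ ∷ a₂ ∷ rest) →
    InSign (a₂ ∷ rest) →
    a₂ < a₁ →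
    size rest < a₂ →
    a₁ ∸ a₂ < lastPart a₂ rest →
      IsPartition (hookShape (size (a₁ ∷ a₂ ∷ rest) ∸ a₁) a₁)
      × IsNode (hookShape (size (a₁ ∷ a₂ ∷ rest) ∸ a₁) a₁) 2 1
      × hook (hookShape (size (a₁ ∷ a₂ ∷ rest) ∸ a₁) a₁) 2 1 ≡ a₁
      × χ (hookShape (size (a₁ ∷ a₂ ∷ rest) ∸ a₁) a₁) (a₁ ∷ a₂ ∷ rest)
          ≡ + 2 * ((- (+ 1)) ^ (a₁ ∸ 1))
theorem10 a₁ a₂ [] isP ∉Sign ∈Sign a₂<a₁ _ _ =
  ⊥-elim (<⇒≱ a₂<a₁ (subst (a₁ ≤_) (+-identityʳ a₂) (∉Sign⇒≤size isP ∉Sign ∈Sign)))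
theorem10 a₁ a₂ (k ∷ μ) isP _ _ a₂<a₁ s<a₂ d<last rewrite m+n∸m≡n a₁ (a₂ + (k + sum μ)) =
    hookShape-isPartition a₁ 1≤b
  , hookShape-node₂₁ (a₂ + (k + sum μ)) (≤-<-trans z≤n a₂<a₁)
  , hook-hookShape₂₁ 1≤b (≤-<-trans z≤n a₂<a₁)
  , χ-hookShape≡±2 a₁ a₂ k μ a₂<a₁ s<a₂
      (All.map (<-≤-trans d<last) (lastPart-≤ k μ (Linked.tail (Linked.tail (proj₂ isP)))))
  where
  1≤b : 1 ≤ a₂ + (k + sum μ)
  1≤b = ≤-trans (≤-<-trans z≤n s<a₂) (m≤m+n a₂ (k + sum μ))
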